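{- Let \(G=(V,E)\) be a simple, undirected, connected graph that is not a cactus but such that \(G-e\) is a cactus for every \(e\in E\). Let \(C_1\) and \(C_2\) be two cycles in \(G\) with \(E(C_1)\cap E(C_2)\neq\emptyset\), and let \(C_3\) be a cycle of \(G\) distinct from both \(C_1\) and \(C_2\). Then \(E(C_1)\,\Delta\,E(C_2)\subseteq E(C_3)\).
   Context: A cactus is a connected graph in which every edge belongs to at most one (simple) cycle. \(G-e=(V,E\setminus\{e\})\). \(\Delta\) denotes symmetric difference. -}

module Defs where

open import Data.Nat using (ℕ; suc; _+_; _%_)
open import Data.Nat.DivMod using (m%n<n)
open import Data.Fin using (Fin; toℕ; fromℕ<)
open import Data.Product using (Σ; ∃; _×_; _,_)
open import Data.Sum using (_⊎_)
open import Relation.Nullary using (¬_)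
open import Relation.Binary.PropositionalEquality using (_≡_)
open import Function.Definitions using (Injective)

record Graph (n : ℕ) : Set₁ where
  field
    Adj     : Fin n → Fin n → Set
    sym     : ∀ {x y} → Adj x y → Adj y x
    irrefl  : ∀ {x} → ¬ Adj x x
open Graph public

SameEdge : ∀ {n} → Fin n → Fin n → Fin n → Fin n → Set
SameEdge x y u v = (x ≡ u × y ≡ v) ⊎ (x ≡ v × y ≡ u)

delete : ∀ {n} → Graph n → Fin n → Fin n → Graph n
delete G u v = record
  { Adj    = λ x y → Adj G x y × ¬ SameEdge x y u v
  ; sym    = λ { (a , ne) → sym G a , λ { (_⊎_.inj₁ (p , q)) → ne (_⊎_.inj₂ (q , p))
                                          ; (_⊎_.inj₂ (p , q)) → ne (_⊎_.inj₁ (q , p)) } }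
  ; irrefl = λ { (a , _) → irrefl G a }
  }

data Walk {n} (G : Graph n) : Fin n → Fin n → Set where
  here : ∀ {x} → Walk G x x
  step : ∀ {x y z} → Adj G x y → Walk G y z → Walk G x z

Connected : ∀ {n} → Graph n → Set
Connected G = ∀ x y → Walk G x y

next : ∀ {m} → Fin (suc m) → Fin (suc m)
next {m} i = fromℕ< (m%n<n (suc (toℕ i)) (suc m))

record Cycle {n} (G : Graph n) : Set where
  field
    k     : ℕ
    vtx   : Fin (3 + k) → Fin n
    inj   : Injective _≡_ _≡_ vtx
    adj   : ∀ i → Adj G (vtx i) (vtx (next i))
open Cycle public

InE : ∀ {n} {G : Graph n} → Cycle G → Fin n → Fin n → Set
InE C u v = ∃ λ i → SameEdge (vtx C i) (vtx C (next i)) u v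

-- cycles are identified with their edge sets (as subgraphs)
SameCycle : ∀ {n} {G : Graph n} → Cycle G → Cycle G → Set
SameCycle C D = ∀ u v → (InE C u v → InE D u v) × (InE D u v → InE C u v)

IsCactus : ∀ {n} → Graph n → Set
IsCactus G = Connected G ×
  (∀ u v → Adj G u v → (C D : Cycle G) → InE C u v → InE D u v → SameCycle C D)

SymDiffSub : ∀ {n} {G : Graph n} → Cycle G → Cycle G → Cycle G → Set
SymDiffSub C₁ C₂ C₃ = ∀ u v →
  ((InE C₁ u v × ¬ InE C₂ u v) ⊎ (InE C₂ u v × ¬ InE C₁ u v)) → InE C₃ u v

{-# OPTIONS --safe #-}
module Submission where

-- If two distinct cycles C and D share an edge, then every edge e of G lies
-- on C or on D: otherwise both survive in the cactus G - e and share an edge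
-- there, so they coincide.  Now let uv ∈ E(C₁) ∖ E(C₂) and suppose uv ∉ E(C₃).
-- Then C₂ and C₃ share no edge, so every edge of C₃ lies on C₁; hence C₁ and
-- C₃ share an edge and every edge of C₂ lies on C₁.  But the edge set of a
-- cycle contains that of no other cycle: each vertex of the smaller cycle has
-- two distinct neighbours on it, which must be its two neighbours on the
-- larger one, so the smaller cycle can never leave it.  Thus E(C₁) = E(C₂),
-- contradicting uv ∉ E(C₂).

open import Defs hiding (sym)
open import Data.Nat using (ℕ; zero; suc; _+_; _*_; _∸_; _%_; _/_; NonZero)
open import Data.Nat.Properties using (+-suc; +-identityʳ; +-assoc; +-comm; +-cancelˡ-≡; m+[n∸m]≡n; <⇒≤)
open import Data.Nat.DivMod using (m%n<n; m<n⇒m%n≡m; m%n%n≡m%n; %-distribˡ-+; [m+n]%n≡m%n; m≡m%n+[m/n]*n)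
open import Data.Nat.GeneralisedArithmetic using (iterate)
open import Data.Fin using (Fin; toℕ) renaming (zero to fzero)
open import Data.Fin.Properties using (toℕ-fromℕ<; toℕ-injective; toℕ<n; any?) renaming (_≟_ to _≟ᶠ_)
open import Data.Product using (∃; _×_; _,_; proj₁; proj₂)
open import Data.Sum using (_⊎_; inj₁; inj₂; fromInj₁)
open import Data.Empty using (⊥; ⊥-elim)
open import Relation.Nullary using (¬_; Dec; yes; no)
open import Relation.Nullary.Decidable using (_×-dec_; _⊎-dec_)
open import Relation.Binary.PropositionalEquality
  using (_≡_; _≢_; refl; sym; trans; cong; subst; subst₂; module ≡-Reasoning)
open import Function.Base using (_∘_)
open import Function.Definitions using (Injective)
open ≡-Reasoning

[m%d+n]%d≡[m+n]%d : ∀ m n d .{{_ : NonZero d}} → (m % d + n) % d ≡ (m + n) % d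
[m%d+n]%d≡[m+n]%d m n d = begin
  (m % d + n) % d           ≡⟨ %-distribˡ-+ (m % d) n d ⟩
  (m % d % d + n % d) % d   ≡⟨ cong (λ x → (x + n % d) % d) (m%n%n≡m%n m d) ⟩
  (m % d + n % d) % d       ≡⟨ %-distribˡ-+ m n d ⟨
  (m + n) % d               ∎

iterate-suc : ∀ {a} {A : Set a} (f : A → A) x n → iterate f x (suc n) ≡ f (iterate f x n)
iterate-suc f x zero    = refl
iterate-suc f x (suc n) = iterate-suc f (f x) n

iterate-preserves : ∀ {a p} {A : Set a} (P : A → Set p) {f : A → A} →
                    (∀ {x} → P x → P (f x)) → ∀ {x} n → P x → P (iterate f x n)
iterate-preserves P Pf zero    Px = Px
iterate-preserves P Pf (suc n) Px = iterate-preserves P Pf n (Pf Px)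

module _ {m : ℕ} where

  toℕ-next : (i : Fin (suc m)) → toℕ (next i) ≡ suc (toℕ i) % suc m
  toℕ-next i = toℕ-fromℕ< (m%n<n (suc (toℕ i)) (suc m))

  toℕ-iterate-next : (i : Fin (suc m)) (t : ℕ) → toℕ (iterate next i t) ≡ (toℕ i + t) % suc m
  toℕ-iterate-next i zero = sym (begin
    (toℕ i + 0) % suc m ≡⟨ cong (_% suc m) (+-identityʳ (toℕ i)) ⟩
    toℕ i % suc m       ≡⟨ m<n⇒m%n≡m (toℕ<n i) ⟩
    toℕ i               ∎)
  toℕ-iterate-next i (suc t) = begin
    toℕ (iterate next (next i) t)     ≡⟨ toℕ-iterate-next (next i) t ⟩
    (toℕ (next i) + t) % suc m        ≡⟨ cong (λ x → (x + t) % suc m) (toℕ-next i) ⟩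
    (suc (toℕ i) % suc m + t) % suc m ≡⟨ [m%d+n]%d≡[m+n]%d (suc (toℕ i)) t (suc m) ⟩
    (suc (toℕ i) + t) % suc m         ≡⟨ cong (_% suc m) (+-suc (toℕ i) t) ⟨
    (toℕ i + suc t) % suc m           ∎

  iterate-next-period : (i : Fin (suc m)) → iterate next i (suc m) ≡ i
  iterate-next-period i = toℕ-injective (begin
    toℕ (iterate next i (suc m)) ≡⟨ toℕ-iterate-next i (suc m) ⟩
    (toℕ i + suc m) % suc m      ≡⟨ [m+n]%n≡m%n (toℕ i) (suc m) ⟩
    toℕ i % suc m                ≡⟨ m<n⇒m%n≡m (toℕ<n i) ⟩
    toℕ i                        ∎)

  iterate-next-reaches : (i j : Fin (suc m)) → ∃ λ t → iterate next i t ≡ j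
  iterate-next-reaches i j = t , toℕ-injective (begin
    toℕ (iterate next i t)                      ≡⟨ toℕ-iterate-next i t ⟩
    (toℕ i + (suc m ∸ toℕ i + toℕ j)) % suc m  ≡⟨ cong (_% suc m) (+-assoc (toℕ i) _ (toℕ j)) ⟨
    (toℕ i + (suc m ∸ toℕ i) + toℕ j) % suc m  ≡⟨ cong (λ x → (x + toℕ j) % suc m) (m+[n∸m]≡n (<⇒≤ (toℕ<n i))) ⟩
    (suc m + toℕ j) % suc m                     ≡⟨ cong (_% suc m) (+-comm (suc m) (toℕ j)) ⟩
    (toℕ j + suc m) % suc m                     ≡⟨ [m+n]%n≡m%n (toℕ j) (suc m) ⟩
    toℕ j % suc m                               ≡⟨ m<n⇒m%n≡m (toℕ<n j) ⟩
    toℕ j                                       ∎)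
    where t = suc m ∸ toℕ i + toℕ j

  next-induction : ∀ {p} (P : Fin (suc m) → Set p) → (∀ {i} → P i → P (next i)) →
                   ∀ {i} → P i → ∀ j → P j
  next-induction P P-next {i} Pi j with iterate-next-reaches i j
  ... | t , refl = iterate-preserves P P-next t Pi

  prev : Fin (suc m) → Fin (suc m)
  prev i = iterate next i m

  prev-next : (i : Fin (suc m)) → prev (next i) ≡ i
  prev-next = iterate-next-period

  next-prev : (i : Fin (suc m)) → next (prev i) ≡ i
  next-prev i = trans (sym (iterate-suc next i m)) (iterate-next-period i)

  next-injective : Injective _≡_ _≡_ next
  next-injective {i} {j} eq = begin
    i             ≡⟨ prev-next i ⟨
    prev (next i) ≡⟨ cong prev eq ⟩
    prev (next j) ≡⟨ prev-next j ⟩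
    j             ∎

next∘next≢id : ∀ {k} (i : Fin (3 + k)) → next (next i) ≢ i
next∘next≢id {k} i eq = 2≢multiple q (+-cancelˡ-≡ (toℕ i) 2 (q * N) (begin
  toℕ i + 2               ≡⟨ m≡m%n+[m/n]*n (toℕ i + 2) N ⟩
  (toℕ i + 2) % N + q * N ≡⟨ cong (_+ q * N) (toℕ-iterate-next i 2) ⟨
  toℕ (next (next i)) + q * N ≡⟨ cong (λ j → toℕ j + q * N) eq ⟩
  toℕ i + q * N           ∎))
  where
  N = 3 + k
  q = (toℕ i + 2) / N
  2≢multiple : ∀ q → 2 ≢ q * N
  2≢multiple zero    ()
  2≢multiple (suc q) ()

next≢prev : ∀ {k} (i : Fin (3 + k)) → next i ≢ prev i
next≢prev i eq = next∘next≢id (prev i) (begin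
  next (next (prev i)) ≡⟨ cong next (next-prev i) ⟩
  next i               ≡⟨ eq ⟩
  prev i               ∎)

module _ {n} {G : Graph n} where

  _∈ᵛ_ : Fin n → Cycle G → Set
  x ∈ᵛ C = ∃ λ i → vtx C i ≡ x

  _⊆ᴱ_ : Cycle G → Cycle G → Set
  C ⊆ᴱ D = ∀ u v → InE C u v → InE D u v

  SameCycle-sym : {C D : Cycle G} → SameCycle C D → SameCycle D C
  SameCycle-sym C≈D u v with C≈D u v
  ... | C→D , D→C = D→C , C→D

  SameEdge? : (a b u v : Fin n) → Dec (SameEdge a b u v)
  SameEdge? a b u v = ((a ≟ᶠ u) ×-dec (b ≟ᶠ v)) ⊎-dec ((a ≟ᶠ v) ×-dec (b ≟ᶠ u))

  InE? : (C : Cycle G) (u v : Fin n) → Dec (InE C u v)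
  InE? C u v = any? λ i → SameEdge? (vtx C i) (vtx C (next i)) u v

  InE-sym : (C : Cycle G) {u v : Fin n} → InE C u v → InE C v u
  InE-sym C (i , inj₁ uv) = i , inj₂ uv
  InE-sym C (i , inj₂ vu) = i , inj₁ vu

  InE-resp-SameEdge : (C : Cycle G) {a b u v : Fin n} → InE C a b → SameEdge a b u v → InE C u v
  InE-resp-SameEdge C e (inj₁ (refl , refl)) = e
  InE-resp-SameEdge C e (inj₂ (refl , refl)) = InE-sym C e

  InE⇒Adj : (C : Cycle G) {u v : Fin n} → InE C u v → Adj G u v
  InE⇒Adj C (i , inj₁ (refl , refl)) = adj C i
  InE⇒Adj C (i , inj₂ (refl , refl)) = Graph.sym G (adj C i)

  InE⇒∈ᵛ : (C : Cycle G) {u v : Fin n} → InE C u v → u ∈ᵛ C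
  InE⇒∈ᵛ C (i , inj₁ (cᵢ≡u , _)) = i , cᵢ≡u
  InE⇒∈ᵛ C (i , inj₂ (_ , cₙᵢ≡u)) = next i , cₙᵢ≡u

  InE-next : (C : Cycle G) (i : Fin (3 + k C)) → InE C (vtx C i) (vtx C (next i))
  InE-next C i = i , inj₁ (refl , refl)

  InE-prev : (C : Cycle G) (i : Fin (3 + k C)) → InE C (vtx C i) (vtx C (prev i))
  InE-prev C i = prev i , inj₂ (refl , cong (vtx C) (next-prev i))

  InE-neighbours : (C : Cycle G) {i : Fin (3 + k C)} {w : Fin n} → InE C (vtx C i) w →
                   w ≡ vtx C (next i) ⊎ w ≡ vtx C (prev i)
  InE-neighbours C (t , inj₁ (cₜ≡cᵢ , cₙₜ≡w)) =
    inj₁ (trans (sym cₙₜ≡w) (cong (vtx C ∘ next) (inj C cₜ≡cᵢ)))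
  InE-neighbours C {i} (t , inj₂ (cₜ≡w , cₙₜ≡cᵢ)) =
    inj₂ (trans (sym cₜ≡w) (cong (vtx C) t≡prev))
    where
    t≡prev : t ≡ prev i
    t≡prev = trans (sym (prev-next t)) (cong prev (inj C cₙₜ≡cᵢ))

module _ {n} {G : Graph n} {C D : Cycle G} (D⊆C : D ⊆ᴱ C) where

  private
    c = vtx C
    d = vtx D

  C-neighbours-of-shared : ∀ {i j w} → d i ≡ c j → InE D (d i) w → w ≡ c (next j) ⊎ w ≡ c (prev j)
  C-neighbours-of-shared dᵢ≡cⱼ e = InE-neighbours C (subst (λ x → InE C x _) dᵢ≡cⱼ (D⊆C _ _ e))

  ⊆ᴱ-shared-vertex : ∀ {i j} → d i ≡ c j → InE D (c j) (c (next j))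
  ⊆ᴱ-shared-vertex {i} {j} dᵢ≡cⱼ
    with C-neighbours-of-shared dᵢ≡cⱼ (InE-next D i) | C-neighbours-of-shared dᵢ≡cⱼ (InE-prev D i)
  ... | inj₁ dₙᵢ≡cₙⱼ | _             = subst₂ (InE D) dᵢ≡cⱼ dₙᵢ≡cₙⱼ (InE-next D i)
  ... | _             | inj₁ dₚᵢ≡cₙⱼ = subst₂ (InE D) dᵢ≡cⱼ dₚᵢ≡cₙⱼ (InE-prev D i)
  ... | inj₂ dₙᵢ≡cₚⱼ | inj₂ dₚᵢ≡cₚⱼ =
    ⊥-elim (next≢prev i (inj D (trans dₙᵢ≡cₚⱼ (sym dₚᵢ≡cₚⱼ))))

  ⊆ᴱ-vertices : ∀ j → c j ∈ᵛ D
  ⊆ᴱ-vertices = next-induction (λ j → c j ∈ᵛ D) to-next on-D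
    where
    to-next : ∀ {j} → c j ∈ᵛ D → c (next j) ∈ᵛ D
    to-next (i , dᵢ≡cⱼ) = InE⇒∈ᵛ D (InE-sym D (⊆ᴱ-shared-vertex dᵢ≡cⱼ))
    d₀∈C : d fzero ∈ᵛ C
    d₀∈C = InE⇒∈ᵛ C (D⊆C _ _ (InE-next D fzero))
    on-D : c (proj₁ d₀∈C) ∈ᵛ D
    on-D = fzero , sym (proj₂ d₀∈C)

  ⊆ᴱ⇒⊇ᴱ : C ⊆ᴱ D
  ⊆ᴱ⇒⊇ᴱ u v (j , cⱼcₙⱼ≈uv) with ⊆ᴱ-vertices j
  ... | i , dᵢ≡cⱼ = InE-resp-SameEdge D (⊆ᴱ-shared-vertex dᵢ≡cⱼ) cⱼcₙⱼ≈uv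

restrict : ∀ {n} {G : Graph n} {u v} (C : Cycle G) → ¬ InE C u v → Cycle (delete G u v)
restrict C uv∉C = record
  { k = k C ; vtx = vtx C ; inj = inj C ; adj = λ i → adj C i , λ e → uv∉C (i , e) }

module _ {n} {G : Graph n} (G-e-cactus : ∀ u v → Adj G u v → IsCactus (delete G u v)) where

  sharing-cycles-cover : (C D : Cycle G) → ¬ SameCycle C D → ∀ {a b} → InE C a b → InE D a b →
                         ∀ {x y} → Adj G x y → InE C x y ⊎ InE D x y
  sharing-cycles-cover C D C≉D {a} {b} ab∈C ab∈D {x} {y} xy∈E with InE? C x y | InE? D x y
  ... | yes xy∈C | _        = inj₁ xy∈C
  ... | no _     | yes xy∈D = inj₂ xy∈D
  ... | no xy∉C  | no xy∉D  =
    ⊥-elim (C≉D (proj₂ (G-e-cactus x y xy∈E) a b ab∈G-xy (restrict C xy∉C) (restrict D xy∉D) ab∈C ab∈D))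
    where
    ab∈G-xy : Adj (delete G x y) a b
    ab∈G-xy = InE⇒Adj C ab∈C , λ ab≈xy → xy∉C (InE-resp-SameEdge C ab∈C ab≈xy)

  sharing-cycles-diff⊆third : (C₁ C₂ C₃ : Cycle G) → ∀ {a b} → InE C₁ a b → InE C₂ a b →
                              ¬ SameCycle C₃ C₁ → ¬ SameCycle C₃ C₂ →
                              ∀ {u v} → InE C₁ u v → ¬ InE C₂ u v → InE C₃ u v
  sharing-cycles-diff⊆third C₁ C₂ C₃ ab∈C₁ ab∈C₂ C₃≉C₁ C₃≉C₂ {u} {v} uv∈C₁ uv∉C₂ with InE? C₃ u v
  ... | yes uv∈C₃ = uv∈C₃
  ... | no uv∉C₃  = ⊥-elim (uv∉C₂ (⊆ᴱ⇒⊇ᴱ {C = C₁} {D = C₂} C₂⊆C₁ u v uv∈C₁))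
    where
    uv∈E : Adj G u v
    uv∈E = InE⇒Adj C₁ uv∈C₁
    C₁≉C₂ : ¬ SameCycle C₁ C₂
    C₁≉C₂ C₁≈C₂ = uv∉C₂ (proj₁ (C₁≈C₂ u v) uv∈C₁)
    C₂≉C₃ : ¬ SameCycle C₂ C₃
    C₂≉C₃ = C₃≉C₂ ∘ SameCycle-sym {C = C₂} {D = C₃}
    C₁≉C₃ : ¬ SameCycle C₁ C₃
    C₁≉C₃ = C₃≉C₁ ∘ SameCycle-sym {C = C₁} {D = C₃}
    C₂∩C₃=∅ : ∀ {x y} → InE C₂ x y → InE C₃ x y → ⊥
    C₂∩C₃=∅ xy∈C₂ xy∈C₃ with sharing-cycles-cover C₂ C₃ C₂≉C₃ xy∈C₂ xy∈C₃ uv∈E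
    ... | inj₁ uv∈C₂ = uv∉C₂ uv∈C₂
    ... | inj₂ uv∈C₃ = uv∉C₃ uv∈C₃
    e₀∈C₃ : InE C₃ (vtx C₃ fzero) (vtx C₃ (next fzero))
    e₀∈C₃ = InE-next C₃ fzero
    e₀∈C₁ : InE C₁ (vtx C₃ fzero) (vtx C₃ (next fzero))
    e₀∈C₁ = fromInj₁ (λ e₀∈C₂ → ⊥-elim (C₂∩C₃=∅ e₀∈C₂ e₀∈C₃))
              (sharing-cycles-cover C₁ C₂ C₁≉C₂ ab∈C₁ ab∈C₂ (InE⇒Adj C₃ e₀∈C₃))
    C₂⊆C₁ : C₂ ⊆ᴱ C₁
    C₂⊆C₁ x y xy∈C₂ = fromInj₁ (λ xy∈C₃ → ⊥-elim (C₂∩C₃=∅ xy∈C₂ xy∈C₃))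
              (sharing-cycles-cover C₁ C₃ C₁≉C₃ e₀∈C₁ e₀∈C₃ (InE⇒Adj C₂ xy∈C₂))

lemma8 : ∀ {n} (G : Graph n) → Connected G → ¬ IsCactus G
    → (∀ u v → Adj G u v → IsCactus (delete G u v))
    → (C₁ C₂ C₃ : Cycle G)
    → (∃ λ u → ∃ λ v → InE C₁ u v × InE C₂ u v)
    → ¬ SameCycle C₃ C₁ → ¬ SameCycle C₃ C₂
    → SymDiffSub C₁ C₂ C₃
lemma8 G _ _ G-e-cactus C₁ C₂ C₃ (a , b , ab∈C₁ , ab∈C₂) C₃≉C₁ C₃≉C₂ u v (inj₁ (uv∈C₁ , uv∉C₂)) =
  sharing-cycles-diff⊆third G-e-cactus C₁ C₂ C₃ ab∈C₁ ab∈C₂ C₃≉C₁ C₃≉C₂ uv∈C₁ uv∉C₂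
lemma8 G _ _ G-e-cactus C₁ C₂ C₃ (a , b , ab∈C₁ , ab∈C₂) C₃≉C₁ C₃≉C₂ u v (inj₂ (uv∈C₂ , uv∉C₁)) =
  sharing-cycles-diff⊆third G-e-cactus C₂ C₁ C₃ ab∈C₂ ab∈C₁ C₃≉C₂ C₃≉C₁ uv∈C₂ uv∉C₁
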